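{- Let $D$ be a positive integer. Suppose the equation $$X'^2 + DY'^2 = 2^{Z'+2},\quad X',Y',Z'\in\mathbb{Z},\ \gcd(X',Y')=1,\ Z'>0 \qquad (*)$$ has solutions, and let $(X'_1,Y'_1,Z'_1)$ be its least solution. If $(y,z)$ is a pair of positive integers with $1 + Dy^2 = 2^{z+2}$, then $X'_1 = 1$ and $(y,z) = (Y'_1,Z'_1)$, except in the case $D=7$ and $(y,z)=(3,4)$.
   Context: The least solution of $(*)$ is the solution $(X'_1,Y'_1,Z'_1)$ in positive integers such that $Z'_1 \le Z'$ for every solution $(X',Y',Z')$ of $(*)$ (such a positive solution is unique when $(*)$ is solvable). -}

module Defs where

open import Data.Nat as ℕ using (ℕ)
open import Data.Integer using (ℤ; +_; _+_; _*_; _^_; _<_; _≤_; 0ℤ)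
open import Data.Integer.GCD using (gcd)
open import Data.Product using (_×_)
open import Relation.Binary.PropositionalEquality using (_≡_)

-- (X , Y , Z) is a solution of (*) :
--   X^2 + D Y^2 = 2^(Z+2),  X Y Z ∈ ℤ,  gcd(X,Y) = 1,  Z > 0.
-- Since Z > 0, the exponent Z+2 is a positive integer; we write it as
-- the natural number  ∣ Z ∣ + 2  (Z is required positive so ∣ Z ∣ = Z).
IsSol : ℕ → ℤ → ℤ → ℤ → Set
IsSol D X Y Z =
  (0ℤ < Z) × (gcd X Y ≡ + 1) ×
  (X * X + (+ D) * (Y * Y) ≡ (+ 2) ^ (Data.Integer.∣ Z ∣ ℕ.+ 2))

IsLeastSol : ℕ → ℤ → ℤ → ℤ → Set
IsLeastSol D X₁ Y₁ Z₁ =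
  (0ℤ < X₁) × (0ℤ < Y₁) × IsSol D X₁ Y₁ Z₁ ×
  (∀ X Y Z → IsSol D X Y Z → Z₁ ≤ Z)

{-# OPTIONS --safe #-}
-- Let (a, b, m) be the least solution and α = (a + b√-D)/2, so that αᾱ = q = 2ᵐ. For a solution
-- (c, d, n) of (*), c and d are odd, and a 2-adic argument shows that one of (c ± d√-D)/2 is divisible
-- by α; the quotient (c' + d'√-D)/2 has norm 2ⁿ⁻ᵐ and, by minimality of m, is ±1 or again comes from a
-- solution of (*). Hence (c + d√-D)/2 = ±αᵏ or ±ᾱᵏ with n = km. For (1, y, z) this gives
-- ±1 = Vₖ = αᵏ + ᾱᵏ. If k = 1 this is the claim. If k ≥ 3 is odd, a divides Vₖ, so a = 1, and then
-- Vₖ ≡ 1 - kq (mod q²) (and Vₖ ≡ 3 (mod 8) when q = 2) excludes Vₖ = ±1. If k = 2j, then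
-- Vⱼ² = ±1 + 2qʲ forces qʲ = 4 and DUⱼ² = 7: the exceptional solution D = 7, y = 3, z = 4.
module Submission where

open import Defs
open import Data.Nat as ℕ using (ℕ; zero; suc)
import Data.Nat.Properties as ℕP
import Data.Nat.Divisibility as ℕD
import Data.Nat.GCD as ℕG
open import Data.Integer as ℤ using (ℤ; +_; -[1+_]; _+_; _*_; _-_; -_; _^_; ∣_∣)
import Data.Integer.Properties as ℤP
open import Data.Integer.DivMod using (_/_; _%_; n%d<d; a≡a%n+[a/n]*n)
import Data.Integer.GCD as ℤG
import Data.Integer.Divisibility as ℤU
import Data.Integer.Divisibility.Signed as ℤS
open import Data.Integer.Tactic.RingSolver using (solve-∀)
open import Data.Product using (∃-syntax; _×_; _,_; proj₁; proj₂; uncurry)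
open import Data.Sum using (_⊎_; inj₁; inj₂; [_,_]′)
open import Data.Empty using (⊥; ⊥-elim)
open import Relation.Nullary using (¬_)
open import Relation.Binary.PropositionalEquality
open import Function using (_$_; _∘_)
import Data.Nat.Induction as ℕI
open import Relation.Nullary.Decidable using (toWitnessFalse)

-- Parity

Even Odd : ℤ → Set
Even x = ∃[ t ] x ≡ + 2 * t
Odd  x = ∃[ t ] x ≡ + 2 * t + + 1

1≢2* : ∀ t → + 1 ≢ + 2 * t
1≢2* t eq with ℕP.m*n≡1⇒m≡1 2 ∣ t ∣ (trans (sym (ℤP.abs-* (+ 2) t)) (cong ∣_∣ (sym eq)))
... | ()

Even⇒¬Odd : ∀ {x} → Even x → ¬ Odd x
Even⇒¬Odd (s , x≡2s) (t , x≡2t+1) = 1≢2* (s - t) (begin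
  + 1                     ≡⟨ add-sub t ⟩
  + 2 * t + + 1 - + 2 * t ≡⟨ cong (_- + 2 * t) (trans (sym x≡2t+1) x≡2s) ⟩
  + 2 * s - + 2 * t       ≡⟨ factor s t ⟩
  + 2 * (s - t)           ∎)
  where
  open ≡-Reasoning
  add-sub : ∀ t → + 1 ≡ + 2 * t + + 1 - + 2 * t
  add-sub = solve-∀
  factor : ∀ s t → + 2 * s - + 2 * t ≡ + 2 * (s - t)
  factor = solve-∀

parity : ∀ x → Even x ⊎ Odd x
parity x with x % + 2 | n%d<d x (+ 2) | a≡a%n+[a/n]*n x (+ 2)
... | 0 | _ | eq = inj₁ (x / + 2 , trans eq (shape₀ (x / + 2)))
  where
  shape₀ : ∀ h → + 0 + h * + 2 ≡ + 2 * h
  shape₀ = solve-∀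
... | 1 | _ | eq = inj₂ (x / + 2 , trans eq (shape₁ (x / + 2)))
  where
  shape₁ : ∀ h → + 1 + h * + 2 ≡ + 2 * h + + 1
  shape₁ = solve-∀
... | suc (suc _) | ℕ.s≤s (ℕ.s≤s ()) | _

Odd-* : ∀ {x y} → Odd x → Odd y → Odd (x * y)
Odd-* (s , refl) (t , refl) = + 2 * s * t + s + t , expand s t
  where
  expand : ∀ s t → (+ 2 * s + + 1) * (+ 2 * t + + 1) ≡ + 2 * (+ 2 * s * t + s + t) + + 1
  expand = solve-∀

Even-*ʳ : ∀ {x} y → Even x → Even (x * y)
Even-*ʳ y (s , refl) = s * y , ℤP.*-assoc (+ 2) s y

Even-*ˡ : ∀ x {y} → Even y → Even (x * y)
Even-*ˡ x {y} y-even = subst Even (ℤP.*-comm y x) (Even-*ʳ x y-even)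

Even+Odd⇒Odd : ∀ {x y} → Even x → Odd y → Odd (x + y)
Even+Odd⇒Odd (s , refl) (t , refl) = s + t , regroup s t
  where
  regroup : ∀ s t → + 2 * s + (+ 2 * t + + 1) ≡ + 2 * (s + t) + + 1
  regroup = solve-∀

Odd-*⇒Odd : ∀ {x y} → Odd (x * y) → Odd x × Odd y
Odd-*⇒Odd {x} {y} xy-odd with parity x | parity y
... | inj₁ x-even | _          = ⊥-elim (Even⇒¬Odd (Even-*ʳ y x-even) xy-odd)
... | inj₂ _      | inj₁ y-even = ⊥-elim (Even⇒¬Odd (Even-*ˡ x y-even) xy-odd)
... | inj₂ x-odd  | inj₂ y-odd  = x-odd , y-odd

Even-square⇒Even : ∀ {x} → Even (x * x) → Even x
Even-square⇒Even {x} x²-even with parity x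
... | inj₁ x-even = x-even
... | inj₂ x-odd  = ⊥-elim (Even⇒¬Odd x²-even (Odd-* x-odd x-odd))

Even-*-suc : ∀ s → Even (s * (s + + 1))
Even-*-suc s with parity s
... | inj₁ s-even      = Even-*ʳ (s + + 1) s-even
... | inj₂ (t , refl) = Even-*ˡ (+ 2 * t + + 1) (t + + 1 , regroup t)
  where
  regroup : ∀ t → + 2 * t + + 1 + + 1 ≡ + 2 * (t + + 1)
  regroup = solve-∀

Even-norm⇒Even-+ : ∀ x y {D} → Odd D → Even (x * x + D * (y * y)) → Even (x + y)
Even-norm⇒Even-+ x y (u , refl) (w , eq) = Even-square⇒Even {x + y} (w - u * (y * y) + x * y , (begin
  (x + y) * (x + y)
    ≡⟨ expand x y u ⟩
  x * x + (+ 2 * u + + 1) * (y * y) - + 2 * u * (y * y) + + 2 * (x * y)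
    ≡⟨ cong (λ z → z - + 2 * u * (y * y) + + 2 * (x * y)) eq ⟩
  + 2 * w - + 2 * u * (y * y) + + 2 * (x * y)
    ≡⟨ factor w u x y ⟩
  + 2 * (w - u * (y * y) + x * y)
    ∎))
  where
  open ≡-Reasoning
  expand : ∀ x y u → (x + y) * (x + y)
                   ≡ x * x + (+ 2 * u + + 1) * (y * y) - + 2 * u * (y * y) + + 2 * (x * y)
  expand = solve-∀
  factor : ∀ w u x y → + 2 * w - + 2 * u * (y * y) + + 2 * (x * y) ≡ + 2 * (w - u * (y * y) + x * y)
  factor = solve-∀

Even-+⇒Even-odd-combination : ∀ x y {a b} → Odd a → Odd b → Even (x + y) → Even (x * a - y * b)
Even-+⇒Even-odd-combination x y (α , refl) (β , refl) (w , x+y≡2w) = w + (x * α - y * β - y) , (begin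
  x * (+ 2 * α + + 1) - y * (+ 2 * β + + 1)   ≡⟨ regroup x y α β ⟩
  (x + y) + + 2 * (x * α - y * β - y)         ≡⟨ cong (_+ + 2 * (x * α - y * β - y)) x+y≡2w ⟩
  + 2 * w + + 2 * (x * α - y * β - y)         ≡⟨ ℤP.*-distribˡ-+ (+ 2) w _ ⟨
  + 2 * (w + (x * α - y * β - y))             ∎)
  where
  open ≡-Reasoning
  regroup : ∀ x y α β → x * (+ 2 * α + + 1) - y * (+ 2 * β + + 1) ≡ (x + y) + + 2 * (x * α - y * β - y)
  regroup = solve-∀

-- Signs

Sign : ℤ → Set
Sign s = s ≡ + 1 ⊎ s ≡ - + 1

Sign-square : ∀ {s} → Sign s → s * s ≡ + 1
Sign-square (inj₁ refl) = refl
Sign-square (inj₂ refl) = refl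

Sign-Odd : ∀ {s} → Sign s → Odd s
Sign-Odd (inj₁ refl) = + 0 , refl
Sign-Odd (inj₂ refl) = - + 1 , refl

Sign-*-square : ∀ {ε} → Sign ε → ∀ d → (ε * d) * (ε * d) ≡ d * d
Sign-*-square {ε} ε-sign d = begin
  (ε * d) * (ε * d) ≡⟨ regroup ε d ⟩
  (ε * ε) * (d * d) ≡⟨ cong (_* (d * d)) (Sign-square ε-sign) ⟩
  + 1 * (d * d)     ≡⟨ ℤP.*-identityˡ (d * d) ⟩
  d * d             ∎
  where
  open ≡-Reasoning
  regroup : ∀ e d → (e * d) * (e * d) ≡ (e * e) * (d * d)
  regroup = solve-∀

*≡1⇒Sign : ∀ x w → x * w ≡ + 1 → Sign x
*≡1⇒Sign x w eq =
  ∣x∣≡1⇒Sign x (ℕP.m*n≡1⇒m≡1 ∣ x ∣ ∣ w ∣ (trans (sym (ℤP.abs-* x w)) (cong ∣_∣ eq)))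
  where
  ∣x∣≡1⇒Sign : ∀ x → ∣ x ∣ ≡ 1 → Sign x
  ∣x∣≡1⇒Sign (+ .1)    refl = inj₁ refl
  ∣x∣≡1⇒Sign -[1+ .0 ] refl = inj₂ refl

positive-Sign⇒≡1 : ∀ {x} → + 0 ℤ.< x → Sign x → x ≡ + 1
positive-Sign⇒≡1 _ (inj₁ x≡1) = x≡1
positive-Sign⇒≡1 () (inj₂ refl)

1≡σ*x⇒x≡σ : ∀ {σ} x → Sign σ → + 1 ≡ σ * x → x ≡ σ
1≡σ*x⇒x≡σ x (inj₁ refl) eq = sym (trans eq (ℤP.*-identityˡ x))
1≡σ*x⇒x≡σ x (inj₂ refl) eq =
  trans (sym (ℤP.neg-involutive x)) (cong -_ (sym (trans eq (ℤP.-1*i≡-i x))))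

ε*d≡σ*w⇒d≡σ*ε*w : ∀ {ε} σ d w → Sign ε → ε * d ≡ σ * w → d ≡ σ * (ε * w)
ε*d≡σ*w⇒d≡σ*ε*w {ε} σ d w ε-sign eq = begin
  d               ≡⟨ ℤP.*-identityˡ d ⟨
  + 1 * d         ≡⟨ cong (_* d) (Sign-square ε-sign) ⟨
  ε * ε * d       ≡⟨ ℤP.*-assoc ε ε d ⟩
  ε * (ε * d)     ≡⟨ cong (ε *_) eq ⟩
  ε * (σ * w)     ≡⟨ exchange ε σ w ⟩
  σ * (ε * w)     ∎
  where
  open ≡-Reasoning
  exchange : ∀ e s w → e * (s * w) ≡ s * (e * w)
  exchange = solve-∀

-- Powers of two

pow₂ : ℕ → ℤ
pow₂ r = (+ 2) ^ r

pow₂-+ : ∀ r s → pow₂ (r ℕ.+ s) ≡ pow₂ r * pow₂ s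
pow₂-+ = ℤP.^-distribˡ-+-* (+ 2)

pow₂[n+2]≡4*pow₂[n] : ∀ n → pow₂ (n ℕ.+ 2) ≡ + 4 * pow₂ n
pow₂[n+2]≡4*pow₂[n] n = trans (pow₂-+ n 2) (ℤP.*-comm (pow₂ n) (+ 4))

pow₂≢0 : ∀ r → pow₂ r ≢ + 0
pow₂≢0 r eq with ℤP.i^n≡0⇒i≡0 (+ 2) r eq
... | ()

instance
  pow₂-nonZero : ∀ {r} → ℤ.NonZero (pow₂ r)
  pow₂-nonZero {r} = ℤ.≢-nonZero (pow₂≢0 r)

pos-pow₂ : ∀ n → + (2 ℕ.^ n) ≡ pow₂ n
pos-pow₂ zero    = refl
pos-pow₂ (suc n) = trans (ℤP.pos-* 2 (2 ℕ.^ n)) (cong (+ 2 *_) (pos-pow₂ n))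

*-cancelˡ-2 : ∀ x y → + 2 * x ≡ + 2 * y → x ≡ y
*-cancelˡ-2 x y = ℤP.*-cancelˡ-≡ (+ 2) x y

pow₂≡2⇒≡1 : ∀ r → pow₂ r ≡ + 2 → r ≡ 1
pow₂≡2⇒≡1 (suc zero)    _  = refl
pow₂≡2⇒≡1 (suc (suc r)) eq = ⊥-elim (1≢2* (pow₂ r) (sym (*-cancelˡ-2 (+ 2 * pow₂ r) (+ 1) eq)))

pow₂∣odd*y⇒pow₂∣y : ∀ m {x} y w → Odd x → x * y ≡ pow₂ m * w → ∃[ s ] y ≡ pow₂ m * s
pow₂∣odd*y⇒pow₂∣y zero    y w x-odd eq = y , sym (ℤP.*-identityˡ y)
pow₂∣odd*y⇒pow₂∣y (suc m) {x} y w x-odd eq with parity y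
... | inj₂ y-odd =
  ⊥-elim (Even⇒¬Odd (pow₂ m * w , trans eq (ℤP.*-assoc (+ 2) (pow₂ m) w)) (Odd-* x-odd y-odd))
... | inj₁ (h , y≡2h) =
  let s , h≡2^ms = pow₂∣odd*y⇒pow₂∣y m h w x-odd (*-cancelˡ-2 (x * h) (pow₂ m * w) (begin
        + 2 * (x * h)    ≡⟨ swap x h ⟩
        x * (+ 2 * h)    ≡⟨ cong (x *_) y≡2h ⟨
        x * y            ≡⟨ eq ⟩
        pow₂ (suc m) * w ≡⟨ ℤP.*-assoc (+ 2) (pow₂ m) w ⟩
        + 2 * (pow₂ m * w) ∎))
  in s , trans y≡2h (trans (cong (+ 2 *_) h≡2^ms) (sym (ℤP.*-assoc (+ 2) (pow₂ m) s)))
  where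
  open ≡-Reasoning
  swap : ∀ x h → + 2 * (x * h) ≡ x * (+ 2 * h)
  swap = solve-∀

pow₂²∣x²⇒pow₂∣x : ∀ r x w → x * x ≡ (pow₂ r * pow₂ r) * w → ∃[ t ] x ≡ pow₂ r * t
pow₂²∣x²⇒pow₂∣x zero    x w eq = x , sym (ℤP.*-identityˡ x)
pow₂²∣x²⇒pow₂∣x (suc r) x w eq =
  let h , x≡2h = Even-square⇒Even {x} (pow₂ r * pow₂ r * w * + 2 , trans eq (pull-2 (pow₂ r) w))
      t , h≡2^rt = pow₂²∣x²⇒pow₂∣x r h w (ℤP.*-cancelˡ-≡ (+ 4) _ _ (begin
        + 4 * (h * h)                        ≡⟨ square-2* h ⟩
        (+ 2 * h) * (+ 2 * h)                ≡⟨ cong (λ z → z * z) x≡2h ⟨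
        x * x                                ≡⟨ eq ⟩
        (+ 2 * pow₂ r) * (+ 2 * pow₂ r) * w  ≡⟨ pull-4 (pow₂ r) w ⟩
        + 4 * (pow₂ r * pow₂ r * w)          ∎))
  in t , trans x≡2h (trans (cong (+ 2 *_) h≡2^rt) (sym (ℤP.*-assoc (+ 2) (pow₂ r) t)))
  where
  open ≡-Reasoning
  pull-2 : ∀ p w → (+ 2 * p) * (+ 2 * p) * w ≡ + 2 * (p * p * w * + 2)
  pull-2 = solve-∀
  pull-4 : ∀ p w → (+ 2 * p) * (+ 2 * p) * w ≡ + 4 * (p * p * w)
  pull-4 = solve-∀
  square-2* : ∀ h → + 4 * (h * h) ≡ (+ 2 * h) * (+ 2 * h)
  square-2* = solve-∀

odd*suc≡pow₂⇒≡1 : ∀ {s} r → Odd s → s * (s + + 1) ≡ pow₂ r → r ≡ 1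
odd*suc≡pow₂⇒≡1 {s} r s-odd eq
  with pow₂∣odd*y⇒pow₂∣y r (s + + 1) (+ 1) s-odd (trans eq (sym (ℤP.*-identityʳ (pow₂ r))))
... | w , s+1≡2^rw with *≡1⇒Sign s w (ℤP.*-cancelˡ-≡ (pow₂ r) (s * w) (+ 1) {{pow₂-nonZero {r}}} (begin
      pow₂ r * (s * w)   ≡⟨ exchange (pow₂ r) s w ⟩
      s * (pow₂ r * w)   ≡⟨ cong (s *_) s+1≡2^rw ⟨
      s * (s + + 1)      ≡⟨ eq ⟩
      pow₂ r             ≡⟨ ℤP.*-identityʳ (pow₂ r) ⟨
      pow₂ r * + 1       ∎))
  where
  open ≡-Reasoning
  exchange : ∀ p s w → p * (s * w) ≡ s * (p * w)
  exchange = solve-∀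
... | inj₁ refl = pow₂≡2⇒≡1 r (sym eq)
... | inj₂ refl = ⊥-elim (pow₂≢0 r (sym eq))

*suc≡pow₂⇒≡1 : ∀ s r → s * (s + + 1) ≡ pow₂ r → r ≡ 1
*suc≡pow₂⇒≡1 s r eq with parity s
... | inj₂ s-odd      = odd*suc≡pow₂⇒≡1 r s-odd eq
... | inj₁ (h , s≡2h) = odd*suc≡pow₂⇒≡1 r (- h - + 1 , reflect-odd s h s≡2h) (trans (reflect s) eq)
  where
  -- s ↦ -(s + 1) preserves s (s + 1) and swaps parity.
  reflect : ∀ s → (- (s + + 1)) * (- (s + + 1) + + 1) ≡ s * (s + + 1)
  reflect = solve-∀
  reflect-odd : ∀ s h → s ≡ + 2 * h → - (s + + 1) ≡ + 2 * (- h - + 1) + + 1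
  reflect-odd s h refl = negate h
    where
    negate : ∀ h → - (+ 2 * h + + 1) ≡ + 2 * (- h - + 1) + + 1
    negate = solve-∀

square≡σ+2^[r+2]⇒ : ∀ v {σ} r → Sign σ → v * v ≡ σ + + 2 * pow₂ (suc r) → σ ≡ + 1 × r ≡ 1
square≡σ+2^[r+2]⇒ v r σ-sign eq with parity v
square≡σ+2^[r+2]⇒ v {σ} r σ-sign eq | inj₁ (s , refl) =
  ⊥-elim (Even⇒¬Odd (+ 2 * s * s - pow₂ (suc r) , (begin
    σ                                          ≡⟨ add-sub σ (pow₂ (suc r)) ⟩
    σ + + 2 * pow₂ (suc r) - + 2 * pow₂ (suc r) ≡⟨ cong (_- + 2 * pow₂ (suc r)) eq ⟨
    + 2 * s * (+ 2 * s) - + 2 * pow₂ (suc r)   ≡⟨ factor s (pow₂ (suc r)) ⟩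
    + 2 * (+ 2 * s * s - pow₂ (suc r))         ∎)) (Sign-Odd σ-sign))
  where
  open ≡-Reasoning
  add-sub : ∀ σ p → σ ≡ σ + + 2 * p - + 2 * p
  add-sub = solve-∀
  factor : ∀ s p → + 2 * s * (+ 2 * s) - + 2 * p ≡ + 2 * (+ 2 * s * s - p)
  factor = solve-∀
square≡σ+2^[r+2]⇒ v r (inj₂ refl) eq | inj₂ (s , refl) =
  ⊥-elim (Even⇒¬Odd (pow₂ r , *-cancelˡ-2 _ _
                      (trans (square+1 s) (trans (cong (_+ + 1) eq) (cancel (pow₂ r)))))
                    (s * s + s , regroup s))
  where
  square+1 : ∀ s → + 2 * (+ 2 * s * s + + 2 * s + + 1) ≡ (+ 2 * s + + 1) * (+ 2 * s + + 1) + + 1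
  square+1 = solve-∀
  cancel : ∀ p → - + 1 + + 2 * (+ 2 * p) + + 1 ≡ + 2 * (+ 2 * p)
  cancel = solve-∀
  regroup : ∀ s → + 2 * s * s + + 2 * s + + 1 ≡ + 2 * (s * s + s) + + 1
  regroup = solve-∀
square≡σ+2^[r+2]⇒ v r (inj₁ refl) eq | inj₂ (s , refl) =
  refl , *suc≡pow₂⇒≡1 s r (ℤP.*-cancelˡ-≡ (+ 4) _ _
                            (trans (square-1 s) (trans (cong (_- + 1) eq) (cancel (pow₂ r)))))
  where
  square-1 : ∀ s → + 4 * (s * (s + + 1)) ≡ (+ 2 * s + + 1) * (+ 2 * s + + 1) - + 1
  square-1 = solve-∀
  cancel : ∀ p → + 1 + + 2 * (+ 2 * p) - + 1 ≡ + 4 * p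
  cancel = solve-∀

-- Coprimality

gcd-*-Sign : ∀ c d {s} → Sign s → ℤG.gcd c (s * d) ≡ ℤG.gcd c d
gcd-*-Sign c d (inj₁ refl) = cong (ℤG.gcd c) (ℤP.*-identityˡ d)
gcd-*-Sign c d (inj₂ refl) =
  cong (λ n → + ℕG.gcd ∣ c ∣ n) (trans (cong ∣_∣ (ℤP.-1*i≡-i d)) (ℤP.∣-i∣≡∣i∣ d))

Even⇒2∣ : ∀ {x} → Even x → + 2 ℤU.∣ x
Even⇒2∣ {x} (t , x≡2t) = ℤS.∣⇒∣ᵤ (ℤS.divides t (trans x≡2t (ℤP.*-comm (+ 2) t)))

2∣⇒Even : ∀ {x} → + 2 ℤU.∣ x → Even x
2∣⇒Even {x} 2∣x with ℤS.∣ᵤ⇒∣ 2∣x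
... | ℤS.divides t x≡t2 = t , trans x≡t2 (ℤP.*-comm t (+ 2))

coprime⇒¬Even×Even : ∀ {c d} → ℤG.gcd c d ≡ + 1 → Even c → Even d → ⊥
coprime⇒¬Even×Even {c} {d} gcd≡1 c-even d-even
  with ℕD.∣1⇒≡1 (subst (+ 2 ℤU.∣_) gcd≡1
                   (ℤG.gcd-greatest {c} {d} {+ 2} (Even⇒2∣ c-even) (Even⇒2∣ d-even)))
... | ()

∣2⇒≡1⊎≡2 : ∀ {n} → n ℕD.∣ 2 → n ≡ 1 ⊎ n ≡ 2
∣2⇒≡1⊎≡2 {zero} 0∣2 with ℕD.0∣⇒≡0 0∣2
... | ()
∣2⇒≡1⊎≡2 {1} _ = inj₁ refl
∣2⇒≡1⊎≡2 {2} _ = inj₂ refl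
∣2⇒≡1⊎≡2 {suc (suc (suc n))} n∣2 with ℕD.∣⇒≤ n∣2
... | ℕ.s≤s (ℕ.s≤s ())

gcd∣2⇒coprime-or-Even : ∀ x y → ℕG.gcd ∣ x ∣ ∣ y ∣ ℕD.∣ 2 →
                        ℤG.gcd x y ≡ + 1 ⊎ (Even x × Even y)
gcd∣2⇒coprime-or-Even x y g∣2 with ∣2⇒≡1⊎≡2 g∣2
... | inj₁ g≡1 = inj₁ (cong +_ g≡1)
... | inj₂ g≡2 = inj₂ (2∣⇒Even (subst (ℕD._∣ ∣ x ∣) g≡2 (ℕG.gcd[m,n]∣m ∣ x ∣ ∣ y ∣)) ,
                       2∣⇒Even (subst (ℕD._∣ ∣ y ∣) g≡2 (ℕG.gcd[m,n]∣n ∣ x ∣ ∣ y ∣)))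

-- gcd(x,y) divides 2c and 2e, hence divides 2 gcd(c,e) = 2.
coprime-or-Even : ∀ {x y c e} α β γ δ → ℤG.gcd c e ≡ + 1 →
                  + 2 * c ≡ x * α + y * β → + 2 * e ≡ x * γ + y * δ →
                  ℤG.gcd x y ≡ + 1 ⊎ (Even x × Even y)
coprime-or-Even {x} {y} {c} {e} α β γ δ gcd≡1 2c≡ 2e≡ =
  gcd∣2⇒coprime-or-Even x y (ℕD.∣-trans (ℕG.gcd-greatest g∣2c g∣2e) (ℕD.∣-reflexive 2gcd≡2))
  where
  g : ℕ
  g = ℕG.gcd ∣ x ∣ ∣ y ∣
  g∣x : ℤG.gcd x y ℤS.∣ x
  g∣x = ℤS.∣ᵤ⇒∣ (ℤG.gcd[i,j]∣i x y)
  g∣y : ℤG.gcd x y ℤS.∣ y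
  g∣y = ℤS.∣ᵤ⇒∣ (ℤG.gcd[i,j]∣j x y)
  g∣combination : ∀ {z} u v → z ≡ x * u + y * v → ℤG.gcd x y ℤS.∣ z
  g∣combination u v z≡ =
    subst (ℤG.gcd x y ℤS.∣_) (sym z≡) (ℤS.∣m∣n⇒∣m+n (ℤS.∣m⇒∣m*n u g∣x) (ℤS.∣m⇒∣m*n v g∣y))
  g∣2c : g ℕD.∣ 2 ℕ.* ∣ c ∣
  g∣2c = subst (g ℕD.∣_) (ℤP.abs-* (+ 2) c) $ ℤS.∣⇒∣ᵤ (g∣combination α β 2c≡)
  g∣2e : g ℕD.∣ 2 ℕ.* ∣ e ∣
  g∣2e = subst (g ℕD.∣_) (ℤP.abs-* (+ 2) e) $ ℤS.∣⇒∣ᵤ (g∣combination γ δ 2e≡)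
  2gcd≡2 : ℕG.gcd (2 ℕ.* ∣ c ∣) (2 ℕ.* ∣ e ∣) ≡ 2
  2gcd≡2 = trans (sym (ℕG.c*gcd[m,n]≡gcd[cm,cn] 2 ∣ c ∣ ∣ e ∣))
                 (cong (2 ℕ.*_) (ℤP.+-injective gcd≡1))

coprime-norm-even⇒Odd : ∀ {D c d} w → Odd D → ℤG.gcd c d ≡ + 1 →
                        c * c + D * (d * d) ≡ + 2 * w → Odd c × Odd d
coprime-norm-even⇒Odd {D} {c} {d} w D-odd gcd≡1 eq with parity c | parity d
... | inj₁ c-even | inj₁ d-even = ⊥-elim (coprime⇒¬Even×Even gcd≡1 c-even d-even)
... | inj₂ c-odd  | inj₂ d-odd  = c-odd , d-odd
... | inj₁ c-even | inj₂ d-odd  =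
  ⊥-elim (Even⇒¬Odd (w , eq) (Even+Odd⇒Odd (Even-*ʳ c c-even) (Odd-* D-odd (Odd-* d-odd d-odd))))
... | inj₂ c-odd  | inj₁ d-even =
  ⊥-elim (Even⇒¬Odd (w , trans (ℤP.+-comm (D * (d * d)) (c * c)) eq)
                    (Even+Odd⇒Odd (Even-*ˡ D (Even-*ʳ d d-even)) (Odd-* c-odd c-odd)))

-- Values of x² + Dy²

square≡pos : ∀ x → x * x ≡ + (∣ x ∣ ℕ.* ∣ x ∣)
square≡pos (+ n)    = sym (ℤP.pos-* n n)
square≡pos -[1+ n ] = refl

ℕ-norm≡4 : ∀ {D} x y → 7 ℕ.≤ D → x ℕ.* x ℕ.+ D ℕ.* (y ℕ.* y) ≡ 4 → y ≡ 0 × x ≡ 2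
ℕ-norm≡4 {D} x (suc k) 7≤D eq with ℕP.≤-trans 7≤D (ℕP.≤-trans (ℕP.m≤m*n D (suc k ℕ.* suc k))
                                      (ℕP.≤-trans (ℕP.m≤n+m _ (x ℕ.* x)) (ℕP.≤-reflexive eq)))
... | ℕ.s≤s (ℕ.s≤s (ℕ.s≤s (ℕ.s≤s ())))
ℕ-norm≡4 {D} x zero 7≤D eq rewrite ℕP.*-zeroʳ D | ℕP.+-identityʳ (x ℕ.* x) = refl , root x eq
  where
  root : ∀ x → x ℕ.* x ≡ 4 → x ≡ 2
  root 0 ()
  root 1 ()
  root 2 _ = refl
  root (suc (suc (suc x))) eq
    with ℕP.≤-trans (ℕP.*-mono-≤ (ℕP.m≤m+n 3 x) (ℕP.m≤m+n 3 x)) (ℕP.≤-reflexive eq)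
  ... | ℕ.s≤s (ℕ.s≤s (ℕ.s≤s (ℕ.s≤s ())))

norm≡4 : ∀ {D} x y → 7 ℕ.≤ D → x * x + + D * (y * y) ≡ + 4 → y ≡ + 0 × (x ≡ + 2 ⊎ x ≡ - + 2)
norm≡4 {D} x y 7≤D eq with ℕ-norm≡4 ∣ x ∣ ∣ y ∣ 7≤D (ℤP.+-injective (begin
    + (∣ x ∣ ℕ.* ∣ x ∣ ℕ.+ D ℕ.* (∣ y ∣ ℕ.* ∣ y ∣))
      ≡⟨ ℤP.pos-+ (∣ x ∣ ℕ.* ∣ x ∣) _ ⟩
    + (∣ x ∣ ℕ.* ∣ x ∣) + + (D ℕ.* (∣ y ∣ ℕ.* ∣ y ∣))
      ≡⟨ cong (λ w → + (∣ x ∣ ℕ.* ∣ x ∣) + w) (ℤP.pos-* D _) ⟩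
    + (∣ x ∣ ℕ.* ∣ x ∣) + + D * + (∣ y ∣ ℕ.* ∣ y ∣)
      ≡⟨ cong₂ (λ u v → u + + D * v) (square≡pos x) (square≡pos y) ⟨
    x * x + + D * (y * y)
      ≡⟨ eq ⟩
    + 4
      ∎))
  where open ≡-Reasoning
... | ∣y∣≡0 , ∣x∣≡2 = ℤP.∣i∣≡0⇒i≡0 ∣y∣≡0 , ±2 x ∣x∣≡2
  where
  ±2 : ∀ x → ∣ x ∣ ≡ 2 → x ≡ + 2 ⊎ x ≡ - + 2
  ±2 (+ .2)    refl = inj₁ refl
  ±2 -[1+ .1 ] refl = inj₂ refl

-- An odd square is 1 modulo 8.
1+Dy²≡8R⇒1+D≡8v : ∀ D y R → + 1 + D * (y * y) ≡ + 8 * R → Odd D × ∃[ v ] + 1 + D ≡ + 8 * v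
1+Dy²≡8R⇒1+D≡8v D y R eq with parity (D * (y * y))
... | inj₁ Dy²-even = ⊥-elim (Even⇒¬Odd (+ 4 * R , trans eq (8*≡2*4* R))
                        (subst Odd (ℤP.+-comm (D * (y * y)) (+ 1)) (Even+Odd⇒Odd Dy²-even (+ 0 , refl))))
  where
  8*≡2*4* : ∀ R → + 8 * R ≡ + 2 * (+ 4 * R)
  8*≡2*4* = solve-∀
... | inj₂ Dy²-odd with Odd-*⇒Odd Dy²-odd
... | D-odd , y²-odd with Odd-*⇒Odd {y} {y} y²-odd
... | (s , y≡2s+1) , _ with Even-*-suc s
... | h , s[s+1]≡2h = D-odd , R - D * h , (begin
  + 1 + D
    ≡⟨ split D s ⟩
  + 1 + D * ((+ 2 * s + + 1) * (+ 2 * s + + 1)) - + 4 * D * (s * (s + + 1))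
    ≡⟨ cong (λ y → + 1 + D * (y * y) - + 4 * D * (s * (s + + 1))) y≡2s+1 ⟨
  + 1 + D * (y * y) - + 4 * D * (s * (s + + 1))
    ≡⟨ cong₂ (λ u v → u - + 4 * D * v) eq s[s+1]≡2h ⟩
  + 8 * R - + 4 * D * (+ 2 * h)
    ≡⟨ factor R D h ⟩
  + 8 * (R - D * h)
    ∎)
  where
  open ≡-Reasoning
  split : ∀ D s → + 1 + D ≡ + 1 + D * ((+ 2 * s + + 1) * (+ 2 * s + + 1)) - + 4 * D * (s * (s + + 1))
  split = solve-∀
  factor : ∀ R D h → + 8 * R - + 4 * D * (+ 2 * h) ≡ + 8 * (R - D * h)
  factor = solve-∀

1+Dy²≡2^[z+2]⇒7≤D : ∀ D y z → 1 ℕ.≤ z → + 1 + + D * (+ y * + y) ≡ pow₂ (z ℕ.+ 2) →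
                    7 ℕ.≤ D × Odd (+ D)
1+Dy²≡2^[z+2]⇒7≤D D y (suc z) _ eq =
  let D-odd , v , 1+D≡8v = 1+Dy²≡8R⇒1+D≡8v (+ D) (+ y) (pow₂ z)
                              (trans eq (trans (cong (+ 2 *_) (pow₂-+ z 2)) (regroup (pow₂ z))))
  in 7≤ D v 1+D≡8v , D-odd
  where
  regroup : ∀ p → + 2 * (p * + 4) ≡ + 8 * p
  regroup = solve-∀
  7≤ : ∀ D v → + 1 + + D ≡ + 8 * v → 7 ℕ.≤ D
  7≤ D (+ zero)  ()
  7≤ D -[1+ _ ]  ()
  7≤ D (+ suc w) eq = ℕP.≤-pred (ℕP.≤-trans (ℕP.m≤m*n 8 (suc w))
    (ℕP.≤-reflexive (sym (ℤP.+-injective (trans eq (sym (ℤP.pos-* 8 (suc w))))))))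

1+7y²≡64⇒y≡3 : ∀ y → 1 ℕ.+ 7 ℕ.* (y ℕ.* y) ≡ 2 ℕ.^ (4 ℕ.+ 2) → y ≡ 3
1+7y²≡64⇒y≡3 0 ()
1+7y²≡64⇒y≡3 1 ()
1+7y²≡64⇒y≡3 2 ()
1+7y²≡64⇒y≡3 3 _ = refl
1+7y²≡64⇒y≡3 (suc (suc (suc (suc y)))) eq = ⊥-elim (toWitnessFalse {a? = 113 ℕ.≤? 64} _
  (ℕP.≤-trans (ℕ.s≤s (ℕP.*-monoʳ-≤ 7 (ℕP.*-mono-≤ (ℕP.m≤m+n 4 y) (ℕP.m≤m+n 4 y))))
              (ℕP.≤-reflexive eq)))

-- Lucas sequences

double : ℕ → ℕ
double zero    = zero
double (suc n) = suc (suc (double n))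

double≡+ : ∀ n → double n ≡ n ℕ.+ n
double≡+ zero    = refl
double≡+ (suc n) = cong suc (trans (cong suc (double≡+ n)) (sym (ℕP.+-suc n n)))

even⊎odd : ∀ k → (∃[ i ] k ≡ double i) ⊎ (∃[ i ] k ≡ suc (double i))
even⊎odd zero = inj₁ (0 , refl)
even⊎odd (suc k) with even⊎odd k
... | inj₁ (i , k≡2i)   = inj₂ (i , cong suc k≡2i)
... | inj₂ (i , k≡2i+1) = inj₁ (suc i , cong suc k≡2i+1)

lucas : (a q x₀ x₁ : ℤ) → ℕ → ℤ
lucas a q x₀ x₁ zero          = x₀
lucas a q x₀ x₁ (suc zero)    = x₁
lucas a q x₀ x₁ (suc (suc j)) = a * lucas a q x₀ x₁ (suc j) - q * lucas a q x₀ x₁ j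

module _ (a q : ℤ) where

  Recurrent : (ℕ → ℤ) → Set
  Recurrent f = ∀ j → f (suc (suc j)) ≡ a * f (suc j) - q * f j

  2*-recurrent : ∀ {f} → Recurrent f → Recurrent (λ j → + 2 * f j)
  2*-recurrent {f} rec j = trans (cong (+ 2 *_) (rec j)) (distrib a q (f (suc j)) (f j))
    where
    distrib : ∀ a q x y → + 2 * (a * x - q * y) ≡ a * (+ 2 * x) - q * (+ 2 * y)
    distrib = solve-∀

  recurrent-unique : ∀ {f g} → Recurrent f → Recurrent g → f 0 ≡ g 0 → f 1 ≡ g 1 →
                     ∀ j → f j ≡ g j
  recurrent-unique {f} {g} rec-f rec-g eq₀ eq₁ j = proj₁ (agree j)
    where
    agree : ∀ j → f j ≡ g j × f (suc j) ≡ g (suc j)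
    agree zero    = eq₀ , eq₁
    agree (suc j) = let eqⱼ , eqⱼ₊₁ = agree j in
      eqⱼ₊₁ , trans (rec-f j) (trans (cong₂ (λ u v → a * u - q * v) eqⱼ₊₁ eqⱼ) (sym (rec-g j)))

  a∣V-odd : ∀ i → ∃[ t ] lucas a q (+ 2) a (suc (double i)) ≡ a * t
  a∣V-odd zero    = + 1 , sym (ℤP.*-identityʳ a)
  a∣V-odd (suc i) = let t , V≡at = a∣V-odd i in
    lucas a q (+ 2) a (suc (suc (double i))) - q * t ,
    trans (cong (λ z → a * lucas a q (+ 2) a (suc (suc (double i))) - q * z) V≡at) (factor a q _ t)
    where
    factor : ∀ a q v t → a * v - q * (a * t) ≡ a * (v - q * t)
    factor = solve-∀

module LucasIdentities (a b q D : ℤ) (norm : a * a + D * (b * b) ≡ + 4 * q) where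

  -- αᵏ = (V k + U k √-D)/2 for α = (a + b √-D)/2, whose norm is q.
  V U : ℕ → ℤ
  V = lucas a q (+ 2) a
  U = lucas a q (+ 0) b

  2V-suc : ∀ j → + 2 * V (suc j) ≡ a * V j - D * (b * U j)
  2V-suc = recurrent-unique a q (2*-recurrent a q (λ j → refl))
    (λ j → step a q D b (V (suc j)) (V j) (U (suc j)) (U j)) (base₀ a D b) base₁
    where
    step : ∀ a q D b v₁ v₀ u₁ u₀ → a * (a * v₁ - q * v₀) - D * (b * (a * u₁ - q * u₀))
                                 ≡ a * (a * v₁ - D * (b * u₁)) - q * (a * v₀ - D * (b * u₀))
    step = solve-∀
    base₀ : ∀ a D b → + 2 * a ≡ a * + 2 - D * (b * + 0)
    base₀ = solve-∀
    base₁ : + 2 * (a * a - q * + 2) ≡ a * a - D * (b * b)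
    base₁ = trans (expand a q) (trans (cong (λ z → + 2 * (a * a) - z) (sym norm)) (cancel a D b))
      where
      expand : ∀ a q → + 2 * (a * a - q * + 2) ≡ + 2 * (a * a) - + 4 * q
      expand = solve-∀
      cancel : ∀ a D b → + 2 * (a * a) - (a * a + D * (b * b)) ≡ a * a - D * (b * b)
      cancel = solve-∀

  2U-suc : ∀ j → + 2 * U (suc j) ≡ b * V j + a * U j
  2U-suc = recurrent-unique a q (2*-recurrent a q (λ j → refl))
    (λ j → step a q b (V (suc j)) (V j) (U (suc j)) (U j)) (base₀ a b) (base₁ a q b)
    where
    step : ∀ a q b v₁ v₀ u₁ u₀ → b * (a * v₁ - q * v₀) + a * (a * u₁ - q * u₀)
                               ≡ a * (b * v₁ + a * u₁) - q * (b * v₀ + a * u₀)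
    step = solve-∀
    base₀ : ∀ a b → + 2 * b ≡ b * + 2 + a * + 0
    base₀ = solve-∀
    base₁ : ∀ a q b → + 2 * (a * b - q * + 0) ≡ b * a + a * b
    base₁ = solve-∀

  aV+DbU : ∀ j → a * V (suc j) + D * (b * U (suc j)) ≡ + 2 * q * V j
  aV+DbU = recurrent-unique a q
    (λ j → step a q D b (V (suc (suc j))) (V (suc j)) (U (suc (suc j))) (U (suc j)))
    (λ j → scale a q (V (suc j)) (V j)) (trans norm (4≡2*2 q)) base₁
    where
    step : ∀ a q D b v₁ v₀ u₁ u₀ → a * (a * v₁ - q * v₀) + D * (b * (a * u₁ - q * u₀))
                                 ≡ a * (a * v₁ + D * (b * u₁)) - q * (a * v₀ + D * (b * u₀))
    step = solve-∀
    scale : ∀ a q v₁ v₀ → + 2 * q * (a * v₁ - q * v₀) ≡ a * (+ 2 * q * v₁) - q * (+ 2 * q * v₀)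
    scale = solve-∀
    4≡2*2 : ∀ q → + 4 * q ≡ + 2 * q * + 2
    4≡2*2 = solve-∀
    base₁ : a * (a * a - q * + 2) + D * (b * (a * b - q * + 0)) ≡ + 2 * q * a
    base₁ = trans (expand a q D b) (trans (cong (λ z → a * z - + 2 * q * a) norm) (cancel a q))
      where
      expand : ∀ a q D b → a * (a * a - q * + 2) + D * (b * (a * b - q * + 0))
                         ≡ a * (a * a + D * (b * b)) - + 2 * q * a
      expand = solve-∀
      cancel : ∀ a q → a * (+ 4 * q) - + 2 * q * a ≡ + 2 * q * a
      cancel = solve-∀

  2V-+ : ∀ i j → + 2 * V (j ℕ.+ i) ≡ V i * V j - D * (U i * U j)
  2V-+ i = recurrent-unique a q (2*-recurrent a q (λ j → refl))
    (λ j → step a q D (V i) (U i) (V (suc j)) (V j) (U (suc j)) (U j))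
    (base₀ (V i) D (U i)) (trans (2V-suc i) (base₁ a b (V i) D (U i)))
    where
    step : ∀ a q D vᵢ uᵢ v₁ v₀ u₁ u₀ → vᵢ * (a * v₁ - q * v₀) - D * (uᵢ * (a * u₁ - q * u₀))
                                     ≡ a * (vᵢ * v₁ - D * (uᵢ * u₁)) - q * (vᵢ * v₀ - D * (uᵢ * u₀))
    step = solve-∀
    base₀ : ∀ vᵢ D uᵢ → + 2 * vᵢ ≡ vᵢ * + 2 - D * (uᵢ * + 0)
    base₀ = solve-∀
    base₁ : ∀ a b vᵢ D uᵢ → a * vᵢ - D * (b * uᵢ) ≡ vᵢ * a - D * (uᵢ * b)
    base₁ = solve-∀

  -- Multiplicativity of the norm (x² + Dy²)/4.
  V²+DU² : ∀ j → V j * V j + D * (U j * U j) ≡ + 4 * q ^ j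
  V²+DU² zero    = base D
    where
    base : ∀ D → + 2 * + 2 + D * (+ 0 * + 0) ≡ + 4 * + 1
    base = solve-∀
  V²+DU² (suc j) = ℤP.*-cancelˡ-≡ (+ 4) _ _ (begin
    + 4 * (V (suc j) * V (suc j) + D * (U (suc j) * U (suc j)))
      ≡⟨ double-both (V (suc j)) (U (suc j)) D ⟩
    (+ 2 * V (suc j)) * (+ 2 * V (suc j)) + D * ((+ 2 * U (suc j)) * (+ 2 * U (suc j)))
      ≡⟨ cong₂ (λ x y → x * x + D * (y * y)) (2V-suc j) (2U-suc j) ⟩
    (a * V j - D * (b * U j)) * (a * V j - D * (b * U j)) + D * ((b * V j + a * U j) * (b * V j + a * U j))
      ≡⟨ brahmagupta a b D (V j) (U j) ⟩
    (a * a + D * (b * b)) * (V j * V j + D * (U j * U j))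
      ≡⟨ cong₂ _*_ norm (V²+DU² j) ⟩
    (+ 4 * q) * (+ 4 * q ^ j)
      ≡⟨ regroup q (q ^ j) ⟩
    + 4 * (+ 4 * q ^ suc j)
      ∎)
    where
    open ≡-Reasoning
    double-both : ∀ v u D → + 4 * (v * v + D * (u * u))
                          ≡ (+ 2 * v) * (+ 2 * v) + D * ((+ 2 * u) * (+ 2 * u))
    double-both = solve-∀
    brahmagupta : ∀ a b D v u → (a * v - D * (b * u)) * (a * v - D * (b * u))
                                + D * ((b * v + a * u) * (b * v + a * u))
                              ≡ (a * a + D * (b * b)) * (v * v + D * (u * u))
    brahmagupta = solve-∀
    regroup : ∀ q r → (+ 4 * q) * (+ 4 * r) ≡ + 4 * (+ 4 * (q * r))
    regroup = solve-∀

pos-double : ∀ i → + double i ≡ + 2 * + i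
pos-double i = trans (cong +_ (double≡+ i)) (trans (ℤP.pos-+ i i) (twice (+ i)))
  where
  twice : ∀ x → x + x ≡ + 2 * x
  twice = solve-∀

V₁ : ℤ → ℕ → ℤ
V₁ q = lucas (+ 1) q (+ 2) (+ 1)

V₁[j+2]≡1-[j+2]q : ∀ q j → ∃[ t ] V₁ q (suc (suc j)) ≡ + 1 - (+ j + + 2) * q + q * q * t
V₁[j+2]≡1-[j+2]q q j = proj₁ (pair j)
  where
  Congruent : ℤ → ℤ → Set
  Congruent x v = ∃[ t ] v ≡ + 1 - (x + + 2) * q + q * q * t
  pair : ∀ j → Congruent (+ j) (V₁ q (suc (suc j))) × Congruent (+ 1 + + j) (V₁ q (suc (suc (suc j))))
  pair zero    = (+ 0 , base₀ q) , (+ 0 , base₁ q)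
    where
    base₀ : ∀ q → + 1 * + 1 - q * + 2 ≡ + 1 - (+ 0 + + 2) * q + q * q * + 0
    base₀ = solve-∀
    base₁ : ∀ q → + 1 * (+ 1 * + 1 - q * + 2) - q * + 1 ≡ + 1 - (+ 1 + + 0 + + 2) * q + q * q * + 0
    base₁ = solve-∀
  pair (suc j) = let (t₀ , eq₀) , (t₁ , eq₁) = pair j in
    (t₁ , eq₁) ,
    (t₁ + (+ j + + 2) - q * t₀ , trans (cong₂ (λ u v → + 1 * u - q * v) eq₁ eq₀) (step (+ j) q t₀ t₁))
    where
    step : ∀ x q t₀ t₁ → + 1 * (+ 1 - (+ 1 + x + + 2) * q + q * q * t₁)
                         - q * (+ 1 - (x + + 2) * q + q * q * t₀)
                       ≡ + 1 - (+ 1 + (+ 1 + x) + + 2) * q + q * q * (t₁ + (x + + 2) - q * t₀)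
    step = solve-∀

V₁[q=2]-odd≡3[mod-8] : ∀ i → ∃[ t ] V₁ (+ 2) (suc (suc (suc (double i)))) ≡ + 8 * t + + 3
V₁[q=2]-odd≡3[mod-8] i = proj₁ (pair i)
  where
  pair : ∀ i → (∃[ t ] V₁ (+ 2) (suc (suc (suc (double i)))) ≡ + 8 * t + + 3)
             × (∃[ t ] V₁ (+ 2) (suc (suc (suc (suc (double i))))) ≡ + 8 * t + + 1)
  pair zero    = (- + 1 , refl) , (+ 0 , refl)
  pair (suc i) = let (t , eq₃) , (u , eq₁) = pair i
                     w = u - + 2 * t - + 1
                     eq₃′ = trans (cong₂ (λ x y → + 1 * x - + 2 * y) eq₁ eq₃) (step₃ t u)
    in (w , eq₃′) , (w - + 2 * u , trans (cong₂ (λ x y → + 1 * x - + 2 * y) eq₃′ eq₁) (step₁ w u))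
    where
    step₃ : ∀ t u → + 1 * (+ 8 * u + + 1) - + 2 * (+ 8 * t + + 3) ≡ + 8 * (u - + 2 * t - + 1) + + 3
    step₃ = solve-∀
    step₁ : ∀ w u → + 1 * (+ 8 * w + + 3) - + 2 * (+ 8 * u + + 1) ≡ + 8 * (w - + 2 * u) + + 1
    step₁ = solve-∀

-- For odd j = 2i + 3: V₁ j = 1 gives q ∣ j, and V₁ j = -1 gives q ∣ 2, i.e. q = 2, where V₁ j ≡ 3 (mod 8).
V₁-odd≢±1 : ∀ m₀ i {σ} → Sign σ → V₁ (pow₂ (suc m₀)) (suc (suc (suc (double i)))) ≢ σ
V₁-odd≢±1 m₀ i (inj₁ refl) V≡1 =
  let t , V≡ = V₁[j+2]≡1-[j+2]q q (suc (double i))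
      j≡qt = ℤP.*-cancelˡ-≡ q j (q * t) {{pow₂-nonZero {suc m₀}}} (begin
        q * j
          ≡⟨ rearrange j q t ⟩
        (+ 1 - (+ 1 - j * q + q * q * t)) + q * (q * t)
          ≡⟨ cong (λ v → (+ 1 - v) + q * (q * t)) (trans (sym V≡) V≡1) ⟩
        (+ 1 - + 1) + q * (q * t)
          ≡⟨ ℤP.+-identityˡ (q * (q * t)) ⟩
        q * (q * t)
          ∎)
  in Even⇒¬Odd (pow₂ m₀ * t , trans j≡qt (ℤP.*-assoc (+ 2) (pow₂ m₀) t)) j-odd
  where
  open ≡-Reasoning
  q j : ℤ
  q = pow₂ (suc m₀)
  j = + suc (double i) + + 2
  j-odd : Odd j
  j-odd = + i + + 1 , trans (cong (λ w → + 1 + w + + 2) (pos-double i)) (regroup (+ i))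
    where
    regroup : ∀ i → + 1 + + 2 * i + + 2 ≡ + 2 * (i + + 1) + + 1
    regroup = solve-∀
  rearrange : ∀ j q t → q * j ≡ (+ 1 - (+ 1 - j * q + q * q * t)) + q * (q * t)
  rearrange = solve-∀
V₁-odd≢±1 zero i (inj₂ refl) V≡-1 =
  let t , V≡ = V₁[q=2]-odd≡3[mod-8] i
  in 1≢2* (- t) (sym (ℤP.*-cancelˡ-≡ (+ 4) _ _
       (trans (rearrange t) (cong (λ v → + 4 * + 1 - v - + 1) (trans (sym V≡) V≡-1)))))
  where
  rearrange : ∀ t → + 4 * (+ 2 * (- t)) ≡ + 4 * + 1 - (+ 8 * t + + 3) - + 1
  rearrange = solve-∀
V₁-odd≢±1 (suc m₁) i (inj₂ refl) V≡-1 =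
  let t , V≡ = V₁[j+2]≡1-[j+2]q q (suc (double i))
      2≡q*w = trans (cong (λ v → + 1 - v) (trans (sym V≡-1) V≡)) (rearrange j q t)
  in 1≢2* (pow₂ m₁ * (j - q * t)) (*-cancelˡ-2 _ _ (trans 2≡q*w (regroup (pow₂ m₁) (j - q * t))))
  where
  q j : ℤ
  q = pow₂ (suc (suc m₁))
  j = + suc (double i) + + 2
  rearrange : ∀ j q t → + 1 - (+ 1 - j * q + q * q * t) ≡ q * (j - q * t)
  rearrange = solve-∀
  regroup : ∀ p w → + 2 * (+ 2 * p) * w ≡ + 2 * (+ 2 * (p * w))
  regroup = solve-∀

-- Descent from the least solution

module LeastSolution (D : ℕ) (a b : ℤ) (m₀ : ℕ) (7≤D : 7 ℕ.≤ D) (D-odd : Odd (+ D))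
  (gcd≡1 : ℤG.gcd a b ≡ + 1) (norm-ab : a * a + + D * (b * b) ≡ pow₂ (suc m₀ ℕ.+ 2))
  (least : ∀ X Y Z → IsSol D X Y Z → + suc m₀ ℤ.≤ Z) where

  m : ℕ
  m = suc m₀

  q : ℤ
  q = pow₂ m

  norm : a * a + + D * (b * b) ≡ + 4 * q
  norm = trans norm-ab (pow₂[n+2]≡4*pow₂[n] m)

  open LucasIdentities a b q (+ D) norm public

  a-odd×b-odd : Odd a × Odd b
  a-odd×b-odd = coprime-norm-even⇒Odd (+ 2 * q) D-odd gcd≡1 (trans norm (ℤP.*-assoc (+ 2) (+ 2) q))

  a-odd : Odd a
  a-odd = proj₁ a-odd×b-odd

  b-odd : Odd b
  b-odd = proj₂ a-odd×b-odd

  -- With α = (a + b √-D)/2: (c + e √-D)/2 = α (c' + d' √-D)/2.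
  IsQuotient : ℤ → ℤ → ℤ → ℤ → Set
  IsQuotient c e c' d' = (+ 2 * c ≡ c' * a - + D * (d' * b)) × (+ 2 * e ≡ c' * b + d' * a)

  -- (c + d √-D)/2 is σαᵏ (ε = 1) or σᾱᵏ (ε = -1).
  Represents : ℕ → ℤ → ℤ → Set
  Represents k c d = ∃[ σ ] Sign σ × ∃[ ε ] Sign ε × c ≡ σ * V k × d ≡ σ * (ε * U k)

  -- (ad - bc)(ad + bc) = 4q(d² - 2ⁿb²), written with ad = 2A + 1 and bc = 2B + 1.
  halves-product : ∀ {c d A B} n → c * c + + D * (d * d) ≡ + 4 * (q * pow₂ n) →
                   a * d ≡ + 2 * A + + 1 → b * c ≡ + 2 * B + + 1 →
                   (A - B) * (A + B + + 1) ≡ q * (d * d - pow₂ n * (b * b))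
  halves-product {c} {d} {A} {B} n norm-cd ad≡2A+1 bc≡2B+1 = ℤP.*-cancelˡ-≡ (+ 4) _ _ (begin
    + 4 * ((A - B) * (A + B + + 1))
      ≡⟨ difference-of-squares A B ⟩
    (+ 2 * A + + 1 - (+ 2 * B + + 1)) * (+ 2 * A + + 1 + (+ 2 * B + + 1))
      ≡⟨ cong₂ (λ u v → (u - v) * (u + v)) ad≡2A+1 bc≡2B+1 ⟨
    (a * d - b * c) * (a * d + b * c)
      ≡⟨ eliminate a b c d (+ D) ⟩
    d * d * (a * a + + D * (b * b)) - b * b * (c * c + + D * (d * d))
      ≡⟨ cong₂ (λ u v → d * d * u - b * b * v) norm norm-cd ⟩
    d * d * (+ 4 * q) - b * b * (+ 4 * (q * pow₂ n))
      ≡⟨ factor q (pow₂ n) b d ⟩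
    + 4 * (q * (d * d - pow₂ n * (b * b)))
      ∎)
    where
    open ≡-Reasoning
    difference-of-squares : ∀ A B → + 4 * ((A - B) * (A + B + + 1))
                                  ≡ (+ 2 * A + + 1 - (+ 2 * B + + 1)) * (+ 2 * A + + 1 + (+ 2 * B + + 1))
    difference-of-squares = solve-∀
    eliminate : ∀ a b c d D → (a * d - b * c) * (a * d + b * c)
                            ≡ d * d * (a * a + D * (b * b)) - b * b * (c * c + D * (d * d))
    eliminate = solve-∀
    factor : ∀ q p b d → d * d * (+ 4 * q) - b * b * (+ 4 * (q * p)) ≡ + 4 * (q * (d * d - p * (b * b)))
    factor = solve-∀

  -- A - B and A + B + 1 have opposite parities, so 2ᵐ divides one of them.
  conjugate-divisible : ∀ {c d} n → Odd c → Odd d → c * c + + D * (d * d) ≡ + 4 * (q * pow₂ n) →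
                        ∃[ ε ] Sign ε × ∃[ d' ] a * (ε * d) - b * c ≡ pow₂ (suc m) * d'
  conjugate-divisible {c} {d} n c-odd d-odd norm-cd
    with Odd-* a-odd d-odd | Odd-* b-odd c-odd
  ... | A , ad≡2A+1 | B , bc≡2B+1 = choose (parity (A - B))
    where
    open ≡-Reasoning
    w : ℤ
    w = d * d - pow₂ n * (b * b)
    product : (A - B) * (A + B + + 1) ≡ q * w
    product = halves-product {A = A} {B = B} n norm-cd ad≡2A+1 bc≡2B+1
    choose : Even (A - B) ⊎ Odd (A - B) →
             ∃[ ε ] Sign ε × ∃[ d' ] a * (ε * d) - b * c ≡ pow₂ (suc m) * d'
    choose (inj₂ A-B-odd) =
      let s , A+B+1≡qs = pow₂∣odd*y⇒pow₂∣y m (A + B + + 1) w A-B-odd product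
      in - + 1 , inj₂ refl , - s , (begin
        a * (- + 1 * d) - b * c             ≡⟨ negate a d b c ⟩
        - (a * d + b * c)                   ≡⟨ cong₂ (λ u v → - (u + v)) ad≡2A+1 bc≡2B+1 ⟩
        - (+ 2 * A + + 1 + (+ 2 * B + + 1)) ≡⟨ halve A B ⟩
        - (+ 2 * (A + B + + 1))             ≡⟨ cong (λ z → - (+ 2 * z)) A+B+1≡qs ⟩
        - (+ 2 * (q * s))                   ≡⟨ regroup q s ⟩
        + 2 * q * (- s)                     ∎)
      where
      negate : ∀ a d b c → a * (- + 1 * d) - b * c ≡ - (a * d + b * c)
      negate = solve-∀
      halve : ∀ A B → - (+ 2 * A + + 1 + (+ 2 * B + + 1)) ≡ - (+ 2 * (A + B + + 1))
      halve = solve-∀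
      regroup : ∀ q s → - (+ 2 * (q * s)) ≡ + 2 * q * (- s)
      regroup = solve-∀
    choose (inj₁ (t , A-B≡2t)) =
      let s , A-B≡qs = pow₂∣odd*y⇒pow₂∣y m (A - B) w A+B+1-odd
                         (trans (ℤP.*-comm (A + B + + 1) (A - B)) product)
      in + 1 , inj₁ refl , s , (begin
        a * (+ 1 * d) - b * c           ≡⟨ cong (λ z → a * z - b * c) (ℤP.*-identityˡ d) ⟩
        a * d - b * c                   ≡⟨ cong₂ _-_ ad≡2A+1 bc≡2B+1 ⟩
        + 2 * A + + 1 - (+ 2 * B + + 1) ≡⟨ halve A B ⟩
        + 2 * (A - B)                   ≡⟨ cong (+ 2 *_) A-B≡qs ⟩
        + 2 * (q * s)                   ≡⟨ ℤP.*-assoc (+ 2) q s ⟨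
        + 2 * q * s                     ∎)
      where
      halve : ∀ A B → + 2 * A + + 1 - (+ 2 * B + + 1) ≡ + 2 * (A - B)
      halve = solve-∀
      A+B+1-odd : Odd (A + B + + 1)
      A+B+1-odd = t + B , trans (shift A B) (trans (cong (λ z → z + + 2 * B + + 1) A-B≡2t) (regroup t B))
        where
        shift : ∀ A B → A + B + + 1 ≡ A - B + + 2 * B + + 1
        shift = solve-∀
        regroup : ∀ t B → + 2 * t + + 2 * B + + 1 ≡ + 2 * (t + B) + + 1
        regroup = solve-∀

  -- X = ac + Dbe is divisible by 2q because X² + D(ae - bc)² = (a² + Db²)(c² + De²).
  divide-by-α : ∀ {c e d'} n → c * c + + D * (e * e) ≡ + 4 * (q * pow₂ n) →
                a * e - b * c ≡ pow₂ (suc m) * d' →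
                ∃[ c' ] c' * c' + + D * (d' * d') ≡ + 4 * pow₂ n × IsQuotient c e c' d'
  divide-by-α {c} {e} {d'} n norm-ce conj = c' , norm' , 2c≡ , 2e≡
    where
    open ≡-Reasoning
    X W : ℤ
    X = a * c + + D * (b * e)
    W = + 4 * pow₂ n - + D * (d' * d')
    X²≡ : X * X ≡ (pow₂ (suc m) * pow₂ (suc m)) * W
    X²≡ = begin
      X * X
        ≡⟨ brahmagupta a b c e (+ D) ⟩
      (a * a + + D * (b * b)) * (c * c + + D * (e * e)) - + D * ((a * e - b * c) * (a * e - b * c))
        ≡⟨ cong₂ (λ u v → u * v - + D * ((a * e - b * c) * (a * e - b * c))) norm norm-ce ⟩
      + 4 * q * (+ 4 * (q * pow₂ n)) - + D * ((a * e - b * c) * (a * e - b * c))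
        ≡⟨ cong (λ z → + 4 * q * (+ 4 * (q * pow₂ n)) - + D * (z * z)) conj ⟩
      + 4 * q * (+ 4 * (q * pow₂ n)) - + D * ((+ 2 * q * d') * (+ 2 * q * d'))
        ≡⟨ factor q (pow₂ n) (+ D) d' ⟩
      (+ 2 * q * (+ 2 * q)) * W
        ∎
      where
      brahmagupta : ∀ a b c e D → (a * c + D * (b * e)) * (a * c + D * (b * e))
                                ≡ (a * a + D * (b * b)) * (c * c + D * (e * e))
                                  - D * ((a * e - b * c) * (a * e - b * c))
      brahmagupta = solve-∀
      factor : ∀ q p D d' → + 4 * q * (+ 4 * (q * p)) - D * ((+ 2 * q * d') * (+ 2 * q * d'))
                          ≡ (+ 2 * q * (+ 2 * q)) * (+ 4 * p - D * (d' * d'))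
      factor = solve-∀
    c' : ℤ
    c' = proj₁ (pow₂²∣x²⇒pow₂∣x (suc m) X W X²≡)
    X≡2qc' : X ≡ pow₂ (suc m) * c'
    X≡2qc' = proj₂ (pow₂²∣x²⇒pow₂∣x (suc m) X W X²≡)
    cancel-2q : ∀ {x y} → pow₂ (suc m) * x ≡ pow₂ (suc m) * y → x ≡ y
    cancel-2q {x} {y} = ℤP.*-cancelˡ-≡ (pow₂ (suc m)) x y {{pow₂-nonZero {suc m}}}
    norm' : c' * c' + + D * (d' * d') ≡ + 4 * pow₂ n
    norm' = trans (cong (_+ + D * (d' * d')) c'²≡W) (sub-add (+ 4 * pow₂ n) (+ D * (d' * d')))
      where
      sub-add : ∀ x y → x - y + y ≡ x
      sub-add = solve-∀
      c'²≡W : c' * c' ≡ W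
      c'²≡W = cancel-2q (cancel-2q (begin
        pow₂ (suc m) * (pow₂ (suc m) * (c' * c')) ≡⟨ square-* (pow₂ (suc m)) c' ⟩
        (pow₂ (suc m) * c') * (pow₂ (suc m) * c') ≡⟨ cong (λ z → z * z) X≡2qc' ⟨
        X * X                                     ≡⟨ X²≡ ⟩
        pow₂ (suc m) * pow₂ (suc m) * W           ≡⟨ ℤP.*-assoc (pow₂ (suc m)) (pow₂ (suc m)) W ⟩
        pow₂ (suc m) * (pow₂ (suc m) * W)         ∎))
        where
        square-* : ∀ p c → p * (p * (c * c)) ≡ (p * c) * (p * c)
        square-* = solve-∀
    2c≡ : + 2 * c ≡ c' * a - + D * (d' * b)
    2c≡ = cancel-2q (begin
      + 2 * q * (+ 2 * c)                             ≡⟨ regroup q c ⟩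
      + 4 * q * c                                     ≡⟨ cong (_* c) norm ⟨
      (a * a + + D * (b * b)) * c                     ≡⟨ expand a b c e (+ D) ⟩
      a * X - + D * (b * (a * e - b * c))             ≡⟨ cong₂ (λ u v → a * u - + D * (b * v)) X≡2qc' conj ⟩
      a * (+ 2 * q * c') - + D * (b * (+ 2 * q * d')) ≡⟨ factor (+ 2 * q) c' d' a b (+ D) ⟩
      + 2 * q * (c' * a - + D * (d' * b))             ∎)
      where
      regroup : ∀ q c → + 2 * q * (+ 2 * c) ≡ + 4 * q * c
      regroup = solve-∀
      expand : ∀ a b c e D → (a * a + D * (b * b)) * c
                           ≡ a * (a * c + D * (b * e)) - D * (b * (a * e - b * c))
      expand = solve-∀
      factor : ∀ p c' d' a b D → a * (p * c') - D * (b * (p * d')) ≡ p * (c' * a - D * (d' * b))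
      factor = solve-∀
    2e≡ : + 2 * e ≡ c' * b + d' * a
    2e≡ = cancel-2q (begin
      + 2 * q * (+ 2 * e)                     ≡⟨ regroup q e ⟩
      + 4 * q * e                             ≡⟨ cong (_* e) norm ⟨
      (a * a + + D * (b * b)) * e             ≡⟨ expand a b c e (+ D) ⟩
      b * X + a * (a * e - b * c)             ≡⟨ cong₂ (λ u v → b * u + a * v) X≡2qc' conj ⟩
      b * (+ 2 * q * c') + a * (+ 2 * q * d') ≡⟨ factor (+ 2 * q) c' d' a b ⟩
      + 2 * q * (c' * b + d' * a)             ∎)
      where
      regroup : ∀ q c → + 2 * q * (+ 2 * c) ≡ + 4 * q * c
      regroup = solve-∀
      expand : ∀ a b c e D → (a * a + D * (b * b)) * e
                           ≡ b * (a * c + D * (b * e)) + a * (a * e - b * c)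
      expand = solve-∀
      factor : ∀ p c' d' a b → b * (p * c') + a * (p * d') ≡ p * (c' * b + d' * a)
      factor = solve-∀

  HasQuotient : ℤ → ℤ → ℕ → Set
  HasQuotient c d n = ∃[ ε ] Sign ε × ∃[ c' ] ∃[ d' ]
    c' * c' + + D * (d' * d') ≡ + 4 * pow₂ n × IsQuotient c (ε * d) c' d'

  descent : ∀ {c d} n → Odd c → Odd d → c * c + + D * (d * d) ≡ + 4 * (q * pow₂ n) → HasQuotient c d n
  descent {c} {d} n c-odd d-odd norm-cd =
    let ε , ε-sign , d' , conj = conjugate-divisible n c-odd d-odd norm-cd
        norm-cεd = trans (cong (λ z → c * c + + D * z) (Sign-*-square ε-sign d)) norm-cd
        c' , norm' , quotient = divide-by-α {c} {ε * d} {d'} n norm-cεd conj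
    in ε , ε-sign , c' , d' , norm' , quotient

  norm≡4⇒Represents-0 : ∀ {c' d'} → c' * c' + + D * (d' * d') ≡ + 4 * pow₂ 0 → Represents 0 c' d'
  norm≡4⇒Represents-0 {c'} {d'} eq with norm≡4 c' d' 7≤D eq
  ... | refl , inj₁ refl = + 1 , inj₁ refl , + 1 , inj₁ refl , refl , refl
  ... | refl , inj₂ refl = - + 1 , inj₂ refl , + 1 , inj₁ refl , refl , refl

  -- With c' = 2c₂ and d' = 2d₂ the halved norm c₂² + Dd₂² is even, and c = c₂a - d₂(Db).
  Odd⇒¬Even-quotient : ∀ {c e c' d'} n → Odd c → c' * c' + + D * (d' * d') ≡ + 4 * pow₂ (suc n) →
                       IsQuotient c e c' d' → Even c' → Even d' → ⊥
  Odd⇒¬Even-quotient {c} n c-odd norm' (2c≡ , _) (c₂ , refl) (d₂ , refl) =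
    Even⇒¬Odd (subst Even (sym c≡) (Even-+⇒Even-odd-combination c₂ d₂ a-odd (Odd-* D-odd b-odd)
                 (Even-norm⇒Even-+ c₂ d₂ D-odd (pow₂ n , halved-norm)))) c-odd
    where
    halved-norm : c₂ * c₂ + + D * (d₂ * d₂) ≡ + 2 * pow₂ n
    halved-norm = ℤP.*-cancelˡ-≡ (+ 4) _ _ (trans (quarter c₂ d₂ (+ D)) norm')
      where
      quarter : ∀ c₂ d₂ D → + 4 * (c₂ * c₂ + D * (d₂ * d₂))
                          ≡ + 2 * c₂ * (+ 2 * c₂) + D * (+ 2 * d₂ * (+ 2 * d₂))
      quarter = solve-∀
    c≡ : c ≡ c₂ * a - d₂ * (+ D * b)
    c≡ = *-cancelˡ-2 _ _ (trans 2c≡ (halve c₂ d₂ a b (+ D)))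
      where
      halve : ∀ c₂ d₂ a b D → + 2 * c₂ * a - D * (+ 2 * d₂ * b) ≡ + 2 * (c₂ * a - d₂ * (D * b))
      halve = solve-∀

  IsQuotient-α^k⇒≡α^[k+1] : ∀ {k c d ε} σ → Sign ε →
                             IsQuotient c (ε * d) (σ * V k) (σ * (+ 1 * U k)) →
                             c ≡ σ * V (suc k) × d ≡ σ * (ε * U (suc k))
  IsQuotient-α^k⇒≡α^[k+1] {k} {c} {d} {ε} σ ε-sign (2c≡ , 2εd≡) =
    c≡ , ε*d≡σ*w⇒d≡σ*ε*w σ d (U (suc k)) ε-sign εd≡
    where
    open ≡-Reasoning
    exchange : ∀ σ x → σ * (+ 2 * x) ≡ + 2 * (σ * x)
    exchange = solve-∀
    c≡ : c ≡ σ * V (suc k)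
    c≡ = *-cancelˡ-2 _ _ (begin
      + 2 * c                                        ≡⟨ 2c≡ ⟩
      σ * V k * a - + D * (σ * (+ 1 * U k) * b)      ≡⟨ factor σ (V k) (U k) a b (+ D) ⟩
      σ * (a * V k - + D * (b * U k))                ≡⟨ cong (σ *_) (2V-suc k) ⟨
      σ * (+ 2 * V (suc k))                          ≡⟨ exchange σ (V (suc k)) ⟩
      + 2 * (σ * V (suc k))                          ∎)
      where
      factor : ∀ σ v u a b D → σ * v * a - D * (σ * (+ 1 * u) * b) ≡ σ * (a * v - D * (b * u))
      factor = solve-∀
    εd≡ : ε * d ≡ σ * U (suc k)
    εd≡ = *-cancelˡ-2 _ _ (begin
      + 2 * (ε * d)                                  ≡⟨ 2εd≡ ⟩
      σ * V k * b + σ * (+ 1 * U k) * a              ≡⟨ factor σ (V k) (U k) a b ⟩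
      σ * (b * V k + a * U k)                        ≡⟨ cong (σ *_) (2U-suc k) ⟨
      σ * (+ 2 * U (suc k))                          ≡⟨ exchange σ (U (suc k)) ⟩
      + 2 * (σ * U (suc k))                          ∎)
      where
      factor : ∀ σ v u a b → σ * v * b + σ * (+ 1 * u) * a ≡ σ * (b * v + a * u)
      factor = solve-∀

  represents-suc : ∀ {k c d ε c' d'} → Odd c → Sign ε → IsQuotient c (ε * d) c' d' →
                   Represents k c' d' → Represents (suc k) c d
  represents-suc {k} {ε = ε} c-odd ε-sign quotient (σ , σ-sign , .(+ 1) , inj₁ refl , refl , refl) =
    σ , σ-sign , ε , ε-sign , IsQuotient-α^k⇒≡α^[k+1] {k} σ ε-sign quotient
  represents-suc {zero} {ε = ε} c-odd ε-sign quotient (σ , σ-sign , .(- + 1) , inj₂ refl , refl , refl) =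
    σ , σ-sign , ε , ε-sign , IsQuotient-α^k⇒≡α^[k+1] {zero} σ ε-sign quotient
  -- Here (c + εd √-D)/2 = σ α ᾱᵏ⁺¹ = σ q ᾱᵏ, so c = σ q V k is even.
  represents-suc {suc k} {c} c-odd ε-sign (2c≡ , _) (σ , σ-sign , .(- + 1) , inj₂ refl , refl , refl) =
    ⊥-elim $ Even⇒¬Odd (σ * pow₂ m₀ * V k , *-cancelˡ-2 _ _ (begin
      + 2 * c
        ≡⟨ 2c≡ ⟩
      σ * V (suc k) * a - + D * (σ * (- + 1 * U (suc k)) * b)
        ≡⟨ factor σ (V (suc k)) (U (suc k)) a b (+ D) ⟩
      σ * (a * V (suc k) + + D * (b * U (suc k)))
        ≡⟨ cong (σ *_) (aV+DbU k) ⟩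
      σ * (+ 2 * q * V k)
        ≡⟨ regroup σ (pow₂ m₀) (V k) ⟩
      + 2 * (+ 2 * (σ * pow₂ m₀ * V k))
        ∎)) c-odd
    where
    open ≡-Reasoning
    factor : ∀ σ v u a b D → σ * v * a - D * (σ * (- + 1 * u) * b) ≡ σ * (a * v + D * (b * u))
    factor = solve-∀
    regroup : ∀ σ p v → σ * (+ 2 * (+ 2 * p) * v) ≡ + 2 * (+ 2 * (σ * p * v))
    regroup = solve-∀

  SolutionsArePowers : ℕ → Set
  SolutionsArePowers n = ∀ {c d} → 1 ℕ.≤ n → ℤG.gcd c d ≡ + 1 →
                         c * c + + D * (d * d) ≡ pow₂ (n ℕ.+ 2) →
                         ∃[ k ] n ≡ k ℕ.* m × Represents k c d

  -- Strong induction on n: dividing by α lowers n by m, and minimality of m stops the descent at n = 0.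
  solutions-are-powers : ∀ n → SolutionsArePowers n
  solutions-are-powers = ℕI.<-rec SolutionsArePowers step
    where
    step : ∀ n → (∀ {n'} → n' ℕ.< n → SolutionsArePowers n') → SolutionsArePowers n
    step n rec {c} {d} 1≤n gcd-cd≡1 norm-cd = conclude (descent n' c-odd d-odd norm-cd′)
      where
      m≤n : m ℕ.≤ n
      m≤n = ℤP.drop‿+≤+ (least c d (+ n) (ℤ.+<+ 1≤n , gcd-cd≡1 , norm-cd))
      n' : ℕ
      n' = n ℕ.∸ m
      n≡m+n' : n ≡ m ℕ.+ n'
      n≡m+n' = sym (ℕP.m+[n∸m]≡n m≤n)
      norm-cd′ : c * c + + D * (d * d) ≡ + 4 * (q * pow₂ n')
      norm-cd′ = trans norm-cd (trans (pow₂[n+2]≡4*pow₂[n] n)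
                                      (cong (+ 4 *_) (trans (cong pow₂ n≡m+n') (pow₂-+ m n'))))
      cd-odd : Odd c × Odd d
      cd-odd = coprime-norm-even⇒Odd (+ 2 * (q * pow₂ n')) D-odd gcd-cd≡1
                                     (trans norm-cd′ (ℤP.*-assoc (+ 2) (+ 2) (q * pow₂ n')))
      c-odd : Odd c
      c-odd = proj₁ cd-odd
      d-odd : Odd d
      d-odd = proj₂ cd-odd
      quotient-represented : ∀ n' {c' d' e} → n' ℕ.< n → c' * c' + + D * (d' * d') ≡ + 4 * pow₂ n' →
                             IsQuotient c e c' d' → ℤG.gcd c e ≡ + 1 →
                             ∃[ k ] n' ≡ k ℕ.* m × Represents k c' d'
      quotient-represented zero     _    norm' _ _ = 0 , refl , norm≡4⇒Represents-0 norm'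
      quotient-represented (suc n'') {c'} {d'} {e} n'<n norm' quotient@(2c≡ , 2e≡) gcd-ce≡1 =
        [ (λ gcd'≡1 → rec n'<n (ℕ.s≤s ℕ.z≤n) gcd'≡1
                          (trans norm' (sym (pow₂[n+2]≡4*pow₂[n] (suc n''))))) ,
          ⊥-elim ∘ uncurry (Odd⇒¬Even-quotient n'' c-odd norm' quotient) ]′
        (coprime-or-Even {c'} {d'} {c} {e} a (- (+ D * b)) b a gcd-ce≡1
                         (trans 2c≡ (as-combination c' a d' (+ D) b)) 2e≡)
        where
        as-combination : ∀ c' a d' D b → c' * a - D * (d' * b) ≡ c' * a + d' * (- (D * b))
        as-combination = solve-∀
      conclude : HasQuotient c d n' → ∃[ k ] n ≡ k ℕ.* m × Represents k c d
      conclude (ε , ε-sign , c' , d' , norm' , quotient) =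
        let k , n'≡km , represents = quotient-represented n' {c'} {d'} {ε * d} n'<n norm' quotient
                                                           (trans (gcd-*-Sign c d ε-sign) gcd-cd≡1)
        in suc k , trans n≡m+n' (cong (m ℕ.+_) n'≡km) , represents-suc {k} c-odd ε-sign quotient represents
        where
        n'<n : n' ℕ.< n
        n'<n = subst (n' ℕ.<_) (sym n≡m+n') (ℕP.m<n+m n' (ℕ.s≤s ℕ.z≤n))

  V-odd≡σ⇒Sign-a : ∀ i {σ} → Sign σ → V (suc (double i)) ≡ σ → Sign a
  V-odd≡σ⇒Sign-a i {σ} σ-sign V≡σ = let t , V≡at = a∣V-odd a q i in
    *≡1⇒Sign a (σ * t) (begin
      a * (σ * t) ≡⟨ exchange a σ t ⟩
      σ * (a * t) ≡⟨ cong (σ *_) (trans (sym V≡at) V≡σ) ⟩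
      σ * σ       ≡⟨ Sign-square σ-sign ⟩
      + 1         ∎)
    where
    open ≡-Reasoning
    exchange : ∀ a s t → a * (s * t) ≡ s * (a * t)
    exchange = solve-∀

  -- With j = i + 1 and qʲ = 2ʳ⁺¹: Vⱼ² = σ + 2qʲ forces σ = 1 and qʲ = 4, and then DUⱼ² = 4qʲ - Vⱼ² = 7.
  V-even≡σ⇒D≡7 : ∀ i {σ} → Sign σ → V (double (suc i)) ≡ σ → D ≡ 7 × m ℕ.* suc i ≡ 2
  V-even≡σ⇒D≡7 i {σ} σ-sign V≡σ = D≡7 , cong suc (proj₂ σ≡1×r≡1)
    where
    open ≡-Reasoning
    j r : ℕ
    j = suc i
    r = i ℕ.+ m₀ ℕ.* suc i
    qʲ≡ : q ^ j ≡ pow₂ (suc r)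
    qʲ≡ = ℤP.^-*-assoc (+ 2) m j
    norm-V[j] : V j * V j + + D * (U j * U j) ≡ + 4 * pow₂ (suc r)
    norm-V[j] = trans (V²+DU² j) (cong (+ 4 *_) qʲ≡)
    V[j+j]≡σ : V (j ℕ.+ j) ≡ σ
    V[j+j]≡σ = subst (λ k → V k ≡ σ) (double≡+ j) V≡σ
    V²≡ : V j * V j ≡ σ + + 2 * pow₂ (suc r)
    V²≡ = *-cancelˡ-2 _ _ (begin
      + 2 * (V j * V j)
        ≡⟨ split (V j * V j) (+ D * (U j * U j)) ⟩
      (V j * V j - + D * (U j * U j)) + (V j * V j + + D * (U j * U j))
        ≡⟨ cong₂ _+_ (trans (sym (2V-+ j j)) (cong (+ 2 *_) V[j+j]≡σ)) norm-V[j] ⟩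
      + 2 * σ + + 4 * pow₂ (suc r)
        ≡⟨ factor σ (pow₂ (suc r)) ⟩
      + 2 * (σ + + 2 * pow₂ (suc r))
        ∎)
      where
      split : ∀ x y → + 2 * x ≡ (x - y) + (x + y)
      split = solve-∀
      factor : ∀ s p → + 2 * s + + 4 * p ≡ + 2 * (s + + 2 * p)
      factor = solve-∀
    σ≡1×r≡1 : σ ≡ + 1 × r ≡ 1
    σ≡1×r≡1 = square≡σ+2^[r+2]⇒ (V j) r σ-sign V²≡
    DU²≡7 : + D * (U j * U j) ≡ + 7
    DU²≡7 = begin
      + D * (U j * U j)
        ≡⟨ rearrange (V j * V j) (+ D * (U j * U j)) ⟩
      (V j * V j + + D * (U j * U j)) - V j * V j
        ≡⟨ cong₂ _-_ norm-V[j] V²≡ ⟩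
      + 4 * pow₂ (suc r) - (σ + + 2 * pow₂ (suc r))
        ≡⟨ cong₂ (λ s p → + 4 * p - (s + + 2 * p)) (proj₁ σ≡1×r≡1) (cong (pow₂ ∘ suc) (proj₂ σ≡1×r≡1)) ⟩
      + 7
        ∎
      where
      rearrange : ∀ x y → y ≡ (x + y) - x
      rearrange = solve-∀
    D≡7 : D ≡ 7
    D≡7 = ℕP.≤-antisym (ℕD.∣⇒≤ (ℕD.divides (∣ U j ∣ ℕ.* ∣ U j ∣) (sym (trans (ℕP.*-comm _ D) D∣U∣²≡7)))) 7≤D
      where
      D∣U∣²≡7 : D ℕ.* (∣ U j ∣ ℕ.* ∣ U j ∣) ≡ 7
      D∣U∣²≡7 = ℤP.+-injective (trans (ℤP.pos-* D _) (trans (cong (+ D *_) (sym (square≡pos (U j)))) DU²≡7))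

  V[k+2]≡σ⇒D≡7 : ∀ k {σ} → + 0 ℤ.< a → Sign σ → V (suc (suc k)) ≡ σ →
                 D ≡ 7 × suc (suc k) ℕ.* m ≡ 4
  V[k+2]≡σ⇒D≡7 k {σ} a>0 σ-sign V≡σ with even⊎odd (suc (suc k))
  ... | inj₂ (zero , ())
  ... | inj₁ (zero , ())
  ... | inj₂ (suc i , k+2≡2i+3) =
    ⊥-elim (V₁-odd≢±1 m₀ i σ-sign (subst (λ a → lucas a q (+ 2) a (suc (double (suc i))) ≡ σ)
                                           a≡1 V[2i+3]≡σ))
    where
    V[2i+3]≡σ : V (suc (double (suc i))) ≡ σ
    V[2i+3]≡σ = subst (λ k → V k ≡ σ) k+2≡2i+3 V≡σ
    a≡1 : a ≡ + 1
    a≡1 = positive-Sign⇒≡1 a>0 (V-odd≡σ⇒Sign-a (suc i) σ-sign V[2i+3]≡σ)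
  ... | inj₁ (suc i , k+2≡2i+2) =
    let D≡7 , m[i+1]≡2 = V-even≡σ⇒D≡7 i σ-sign (subst (λ k → V k ≡ σ) k+2≡2i+2 V≡σ)
        [i+1]m≡2 = trans (ℕP.*-comm (suc i) m) m[i+1]≡2
    in D≡7 , (begin
      suc (suc k) ℕ.* m               ≡⟨ cong (ℕ._* m) (trans k+2≡2i+2 (double≡+ (suc i))) ⟩
      (suc i ℕ.+ suc i) ℕ.* m         ≡⟨ ℕP.*-distribʳ-+ m (suc i) (suc i) ⟩
      suc i ℕ.* m ℕ.+ suc i ℕ.* m     ≡⟨ cong₂ ℕ._+_ [i+1]m≡2 [i+1]m≡2 ⟩
      4                               ∎)
    where open ≡-Reasoning

positive : ∀ {x} → + 0 ℤ.< x → ∃[ n ] x ≡ + suc n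
positive {+ suc n} _ = n , refl
positive {+ zero} (ℤ.+<+ ())

pos-1+D*y² : ∀ D y → + (1 ℕ.+ D ℕ.* (y ℕ.* y)) ≡ + 1 + + D * (+ y * + y)
pos-1+D*y² D y =
  trans (ℤP.pos-+ 1 _) (cong (_+_ (+ 1)) (trans (ℤP.pos-* D _) (cong (+ D *_) (ℤP.pos-* y y))))

lemma2p17 : (D : ℕ) → 0 ℕ.< D →
    (X₁ Y₁ Z₁ : ℤ) → IsLeastSol D X₁ Y₁ Z₁ →
    (y z : ℕ) → 0 ℕ.< y → 0 ℕ.< z → 1 ℕ.+ D ℕ.* (y ℕ.* y) ≡ 2 ℕ.^ (z ℕ.+ 2) →
    ¬ (D ≡ 7 × y ≡ 3 × z ≡ 4) →
    (X₁ ≡ + 1) × (+ y ≡ Y₁) × (+ z ≡ Z₁)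
lemma2p17 D _ X₁ Y₁ Z₁ (X₁>0 , Y₁>0 , (Z₁>0 , gcd≡1 , norm-ab) , least) y z _ z>0 1+Dy²≡ not-exception
  with positive X₁>0 | positive Y₁>0 | positive Z₁>0
... | α , refl | β , refl | m₀ , refl =
  classify (solutions-are-powers z z>0 (ℤG.gcd-zeroˡ (+ y)) 1+Dy²≡2^[z+2])
  where
  1+Dy²≡2^[z+2] : + 1 + + D * (+ y * + y) ≡ pow₂ (z ℕ.+ 2)
  1+Dy²≡2^[z+2] = trans (sym (pos-1+D*y² D y)) (trans (cong +_ 1+Dy²≡) (pos-pow₂ (z ℕ.+ 2)))
  7≤D×D-odd : 7 ℕ.≤ D × Odd (+ D)
  7≤D×D-odd = 1+Dy²≡2^[z+2]⇒7≤D D y z z>0 1+Dy²≡2^[z+2]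
  open LeastSolution D (+ suc α) (+ suc β) m₀ (proj₁ 7≤D×D-odd) (proj₂ 7≤D×D-odd) gcd≡1 norm-ab least
  classify : ∃[ k ] z ≡ k ℕ.* m × Represents k (+ 1) (+ y) →
             (+ suc α ≡ + 1) × (+ y ≡ + suc β) × (+ z ≡ + m)
  classify (zero , z≡0 , _) = ⊥-elim (ℕP.<⇒≢ z>0 (sym z≡0))
  classify (1 , z≡m , .(+ 1) , inj₁ refl , .(+ 1) , inj₁ refl , 1≡a , y≡b) =
    sym (trans 1≡a (ℤP.*-identityˡ _)) , trans y≡b (trans (ℤP.*-identityˡ _) (ℤP.*-identityˡ _)) ,
    cong +_ (trans z≡m (ℕP.*-identityˡ m))
  classify (1 , _ , .(+ 1) , inj₁ refl , .(- + 1) , inj₂ refl , _ , ())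
  classify (1 , _ , .(- + 1) , inj₂ refl , _ , _ , () , _)
  classify (suc (suc k) , z≡km , σ , σ-sign , _ , _ , 1≡σV , _) =
    let D≡7 , km≡4 = V[k+2]≡σ⇒D≡7 k (ℤ.+<+ (ℕ.s≤s ℕ.z≤n)) σ-sign (1≡σ*x⇒x≡σ _ σ-sign 1≡σV)
        z≡4 = trans z≡km km≡4
        1+7y²≡2⁶ = subst₂ (λ D z → 1 ℕ.+ D ℕ.* (y ℕ.* y) ≡ 2 ℕ.^ (z ℕ.+ 2)) D≡7 z≡4 1+Dy²≡
    in ⊥-elim (not-exception (D≡7 , 1+7y²≡64⇒y≡3 y 1+7y²≡2⁶ , z≡4))
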